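{- Let $f\in\mathrm{Per}(\mathbb{F}_2^n)$ and let \[V_f=\{0\}\cup\{a\in\mathbb{F}_2^n\setminus\{0\}: f(H(a,0))\text{ is an }(n-1)\text{ -flat}\},\] where $H(a,\epsilon)=\{x\in\mathbb{F}_2^n:\langle a,x\rangle=\epsilon\}$. Then $V_f$ is a linear subspace of $\mathbb{F}_2^n$.
   Context: $\langle a,x\rangle$ is the standard dot product on $\mathbb{F}_2^n$; an $(n-1)$-flat is a coset of an $(n-1)$-dimensional subspace. $\mathrm{Per}(\mathbb{F}_2^n)$ is the group of permutations of $\mathbb{F}_2^n$. -}

module Defs where

open import Data.Bool using (Bool; true; false; _xor_; _∧_)
open import Data.Nat using (ℕ; suc; _∸_)
open import Data.Vec using (Vec; []; _∷_; replicate; zipWith; foldr)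
open import Data.Product using (Σ; _×_; ∃; ∃-syntax)
open import Level using (Lift)
import Level
open import Data.Sum using (_⊎_)
open import Function.Bundles using (Inverse; _↔_; _⇔_)
open import Relation.Binary.PropositionalEquality using (_≡_)
open import Relation.Nullary using (¬_)

-- 𝔽₂ is modelled by Bool (false = 0, true = 1, xor = +, ∧ = ·);
-- 𝔽₂ⁿ is Vec Bool n.
F2^ : ℕ → Set
F2^ n = Vec Bool n

zero-vec : ∀ {n} → F2^ n
zero-vec = replicate _ false

_⊕_ : ∀ {n} → F2^ n → F2^ n → F2^ n
_⊕_ = zipWith _xor_

_·_ : ∀ {n} → Bool → F2^ n → F2^ n
c · v = Data.Vec.map (c ∧_) v

⟨_,_⟩ : ∀ {n} → F2^ n → F2^ n → Bool
⟨ a , x ⟩ = foldr _ _xor_ false (zipWith _∧_ a x)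

H : ∀ {n} → F2^ n → Bool → F2^ n → Set
H a ε x = ⟨ a , x ⟩ ≡ ε

Per : ℕ → Set
Per n = F2^ n ↔ F2^ n

lincomb : ∀ {n k} → Vec Bool k → Vec (F2^ n) k → F2^ n
lincomb [] [] = zero-vec
lincomb (c ∷ cs) (b ∷ bs) = (c · b) ⊕ lincomb cs bs

LinIndep : ∀ {n k} → Vec (F2^ n) k → Set
LinIndep {k = k} B = ∀ c → lincomb c B ≡ zero-vec → c ≡ replicate k false

Subset : ℕ → Set₁
Subset n = F2^ n → Set

HasDim : ∀ {n} → Subset n → ℕ → Set
HasDim {n} W d = Σ (Vec (F2^ n) d) λ B →
  LinIndep B × (∀ y → W y ⇔ (∃[ c ] y ≡ lincomb c B))

IsFlat : ∀ {n} → ℕ → Subset n → Set₁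
IsFlat {n} k S = ∃[ t ] Σ (Subset n) λ W →
  HasDim W k × (∀ y → S y ⇔ (∃[ w ] W w × y ≡ t ⊕ w))

image : ∀ {n} → Per n → Subset n → Subset n
image f A y = ∃[ x ] A x × Inverse.to f x ≡ y

V : ∀ {n} → Per n → F2^ n → Set₁
V {n} f a = Lift (Level.suc Level.zero) (a ≡ zero-vec) ⊎ ((¬ a ≡ zero-vec) × IsFlat (n ∸ 1) (image f (H a false)))

IsSubspace : ∀ {n} → (F2^ n → Set₁) → Set₁
IsSubspace {n} W = W zero-vec × (∀ a b → W a → W b → W (a ⊕ b))
  × (∀ (c : Bool) a → W a → W (c · a))

-- An (n−1)-flat of 𝔽₂ⁿ is the same thing as an affine hyperplane
-- {y : ⟨u,y⟩ = ε} with u ≠ 0. Hence, for a ≠ 0, f(H(a,0)) is a flat iff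
-- ⟨a,x⟩ = ⟨u,f x⟩ + ε for some u, ε and all x, i.e. iff ⟨a,·⟩ ∘ f⁻¹ is an
-- affine functional; adding two such identities shows that these a form a
-- subspace. Identifying flats with hyperplanes needs one dimension count:
-- more than k vectors of 𝔽₂ᵏ are linearly dependent, which follows by
-- Gaussian elimination on the first coordinate.
module Submission where

open import Defs
open import Algebra.Bundles using (CommutativeRing)
open import Data.Bool using (Bool; true; false; _xor_; _∧_; _≟_)
open import Data.Bool.Properties
  using ( xor-assoc; xor-comm; xor-identityʳ; xor-same; ∧-comm; ∧-identityʳ
        ; ∧-zeroʳ; ∧-distribˡ-xor; ∧-distribʳ-xor; xor-∧-commutativeRing )
open import Algebra.Properties.CommutativeSemigroup
  (CommutativeRing.+-commutativeSemigroup xor-∧-commutativeRing)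
  using () renaming (interchange to xor-interchange)
open import Data.Empty using (⊥-elim)
open import Data.Nat using (ℕ; zero; suc; _+_; _<_; _≤_; s≤s)
open import Data.Nat.Properties using (+-suc; +-identityʳ; ≤-pred; <⇒≤; n<1+n)
open import Data.Product using (Σ; _×_; _,_; ∃-syntax)
open import Data.Sum using (inj₁; inj₂)
open import Data.Vec using (Vec; []; _∷_; replicate; zipWith; map; head; tail; _++_; splitAt; transpose)
open import Data.Vec.Properties
  using ( zipWith-comm; zipWith-assoc; zipWith-identityˡ; zipWith-identityʳ; zipWith-is-⊛
        ; map-id; map-const; map-replicate; ∷-injective; ∷-injectiveʳ; ≡-dec )
open import Function using (_∘_)
open import Function.Bundles using (Inverse; Injection; Equivalence; _⇔_; mk⇔)
open import Function.Construct.Composition using (_⇔-∘_)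
open import Function.Construct.Identity using (⇔-id)
open import Function.Construct.Symmetry using (⇔-sym)
open import Function.Properties.Inverse using (↔⇒↣)
open import Level using (lift)
open import Relation.Binary.PropositionalEquality
open import Relation.Nullary using (¬_; yes; no; contradiction)

private
  variable
    n m k p : ℕ

xor≡false⇒≡ : ∀ {x y} → x xor y ≡ false → x ≡ y
xor≡false⇒≡ {false} {false} _ = refl
xor≡false⇒≡ {true}  {true}  _ = refl

≡xor-from-⇔ : ∀ {p q ε} → (p ≡ false ⇔ q ≡ ε) → p ≡ q xor ε
≡xor-from-⇔ {false} {q} {ε} iff rewrite Equivalence.to iff refl = sym (xor-same ε)
≡xor-from-⇔ {true}  {true}  {false} _ = refl
≡xor-from-⇔ {true}  {false} {true}  _ = refl
≡xor-from-⇔ {true}  {true}  {true}  iff = contradiction (Equivalence.from iff refl) λ ()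
≡xor-from-⇔ {true}  {false} {false} iff = contradiction (Equivalence.from iff refl) λ ()

replicate-++ : ∀ {A : Set} p (x : A) → replicate p x ++ replicate m x ≡ replicate (p + m) x
replicate-++ zero    x = refl
replicate-++ (suc p) x = cong (x ∷_) (replicate-++ p x)

F2⁰-trivial : (x : F2^ 0) → x ≡ zero-vec
F2⁰-trivial [] = refl

⊕-comm : (x y : F2^ n) → x ⊕ y ≡ y ⊕ x
⊕-comm = zipWith-comm xor-comm

⊕-assoc : (x y z : F2^ n) → (x ⊕ y) ⊕ z ≡ x ⊕ (y ⊕ z)
⊕-assoc = zipWith-assoc xor-assoc

⊕-identityˡ : (x : F2^ n) → zero-vec ⊕ x ≡ x
⊕-identityˡ = zipWith-identityˡ λ _ → refl

⊕-identityʳ : (x : F2^ n) → x ⊕ zero-vec ≡ x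
⊕-identityʳ = zipWith-identityʳ xor-identityʳ

⊕-self : (x : F2^ n) → x ⊕ x ≡ zero-vec
⊕-self []      = refl
⊕-self (a ∷ x) = cong₂ _∷_ (xor-same a) (⊕-self x)

⊕-interchange : (a b c d : F2^ n) → (a ⊕ b) ⊕ (c ⊕ d) ≡ (a ⊕ c) ⊕ (b ⊕ d)
⊕-interchange []       []       []       []       = refl
⊕-interchange (a ∷ as) (b ∷ bs) (c ∷ cs) (d ∷ ds) =
  cong₂ _∷_ (xor-interchange a b c d) (⊕-interchange as bs cs ds)

⊕-cancelˡ : (x y : F2^ n) → x ⊕ (x ⊕ y) ≡ y
⊕-cancelˡ x y = begin
  x ⊕ (x ⊕ y)   ≡⟨ sym (⊕-assoc x x y) ⟩
  (x ⊕ x) ⊕ y   ≡⟨ cong (_⊕ y) (⊕-self x) ⟩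
  zero-vec ⊕ y  ≡⟨ ⊕-identityˡ y ⟩
  y             ∎
  where open ≡-Reasoning

⊕≡0⇒≡ : {x y : F2^ n} → x ⊕ y ≡ zero-vec → x ≡ y
⊕≡0⇒≡ {x = x} {y} x⊕y≡0 = begin
  x              ≡⟨ sym (⊕-identityʳ x) ⟩
  x ⊕ zero-vec   ≡⟨ sym (cong (x ⊕_) x⊕y≡0) ⟩
  x ⊕ (x ⊕ y)    ≡⟨ ⊕-cancelˡ x y ⟩
  y              ∎
  where open ≡-Reasoning

⊕-rotate : (a b c : F2^ n) → (a ⊕ b) ⊕ c ≡ b ⊕ (a ⊕ c)
⊕-rotate a b c = trans (cong (_⊕ c) (⊕-comm a b)) (⊕-assoc b a c)

·-identityˡ : (x : F2^ n) → true · x ≡ x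
·-identityˡ = map-id

·-zeroˡ : (x : F2^ n) → false · x ≡ zero-vec
·-zeroˡ x = map-const x false

·-zeroʳ : ∀ c → c · zero-vec {n} ≡ zero-vec
·-zeroʳ {n} c = trans (map-replicate (c ∧_) false n) (cong (replicate n) (∧-zeroʳ c))

·-distribʳ : ∀ a b (x : F2^ n) → (a xor b) · x ≡ (a · x) ⊕ (b · x)
·-distribʳ a b []       = refl
·-distribʳ a b (x ∷ xs) = cong₂ _∷_ (∧-distribʳ-xor x a b) (·-distribʳ a b xs)

dot-comm : (a x : F2^ n) → ⟨ a , x ⟩ ≡ ⟨ x , a ⟩
dot-comm []       []       = refl
dot-comm (a ∷ as) (x ∷ xs) = cong₂ _xor_ (∧-comm a x) (dot-comm as xs)

dot-zeroˡ : (x : F2^ n) → ⟨ zero-vec , x ⟩ ≡ false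
dot-zeroˡ []       = refl
dot-zeroˡ (_ ∷ xs) = dot-zeroˡ xs

dot-zeroʳ : (a : F2^ n) → ⟨ a , zero-vec ⟩ ≡ false
dot-zeroʳ a = trans (dot-comm a zero-vec) (dot-zeroˡ a)

dot-⊕ʳ : (a x y : F2^ n) → ⟨ a , x ⊕ y ⟩ ≡ ⟨ a , x ⟩ xor ⟨ a , y ⟩
dot-⊕ʳ []       []       []       = refl
dot-⊕ʳ (a ∷ as) (x ∷ xs) (y ∷ ys) =
  trans (cong₂ _xor_ (∧-distribˡ-xor a x y) (dot-⊕ʳ as xs ys))
        (xor-interchange (a ∧ x) (a ∧ y) ⟨ as , xs ⟩ ⟨ as , ys ⟩)

dot-⊕ˡ : (a b x : F2^ n) → ⟨ a ⊕ b , x ⟩ ≡ ⟨ a , x ⟩ xor ⟨ b , x ⟩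
dot-⊕ˡ a b x = begin
  ⟨ a ⊕ b , x ⟩            ≡⟨ dot-comm (a ⊕ b) x ⟩
  ⟨ x , a ⊕ b ⟩            ≡⟨ dot-⊕ʳ x a b ⟩
  ⟨ x , a ⟩ xor ⟨ x , b ⟩  ≡⟨ cong₂ _xor_ (dot-comm x a) (dot-comm x b) ⟩
  ⟨ a , x ⟩ xor ⟨ b , x ⟩  ∎
  where open ≡-Reasoning

dot-·ʳ : (a : F2^ n) (c : Bool) (x : F2^ n) → ⟨ a , c · x ⟩ ≡ c ∧ ⟨ a , x ⟩
dot-·ʳ a true  x = cong ⟨ a ,_⟩ (·-identityˡ x)
dot-·ʳ a false x = trans (cong ⟨ a ,_⟩ (·-zeroˡ x)) (dot-zeroʳ a)

dot-surjective : (u : F2^ n) → u ≢ zero-vec → ∀ ε → ∃[ x ] ⟨ u , x ⟩ ≡ ε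
dot-surjective []          u≢0 ε = ⊥-elim (u≢0 refl)
dot-surjective (true ∷ u)  _   ε = ε ∷ zero-vec , trans (cong (ε xor_) (dot-zeroʳ u)) (xor-identityʳ ε)
dot-surjective (false ∷ u) u≢0 ε =
  let x , u·x≡ε = dot-surjective u (u≢0 ∘ cong (false ∷_)) ε in false ∷ x , u·x≡ε

Span : Vec (F2^ n) k → Subset n
Span B y = ∃[ c ] y ≡ lincomb c B

-- Over 𝔽₂ additivity is linearity: g 0 = g 0 + g 0 = 0, and scalars are 0 or 1.
Additive : (F2^ n → F2^ m) → Set
Additive g = ∀ x y → g (x ⊕ y) ≡ g x ⊕ g y

additive-zero : (g : F2^ n → F2^ m) → Additive g → g zero-vec ≡ zero-vec
additive-zero g g-additive = begin
  g zero-vec                 ≡⟨ sym (cong g (⊕-self zero-vec)) ⟩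
  g (zero-vec ⊕ zero-vec)    ≡⟨ g-additive zero-vec zero-vec ⟩
  g zero-vec ⊕ g zero-vec    ≡⟨ ⊕-self (g zero-vec) ⟩
  zero-vec                   ∎
  where open ≡-Reasoning

additive-· : (g : F2^ n → F2^ m) → Additive g → ∀ c x → g (c · x) ≡ c · g x
additive-· g _          true  x = trans (cong g (·-identityˡ x)) (sym (·-identityˡ (g x)))
additive-· g g-additive false x =
  trans (cong g (·-zeroˡ x)) (trans (additive-zero g g-additive) (sym (·-zeroˡ (g x))))

lincomb-map : (g : F2^ n → F2^ m) → Additive g →
              (c : Vec Bool k) (B : Vec (F2^ n) k) → lincomb c (map g B) ≡ g (lincomb c B)
lincomb-map g g-additive []       []      = sym (additive-zero g g-additive)
lincomb-map g g-additive (c ∷ cs) (b ∷ B) =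
  trans (cong₂ _⊕_ (sym (additive-· g g-additive c b)) (lincomb-map g g-additive cs B))
        (sym (g-additive (c · b) (lincomb cs B)))

lincomb-false∷ : (c : Vec Bool k) (B : Vec (F2^ n) k) →
                 lincomb c (map (false ∷_) B) ≡ false ∷ lincomb c B
lincomb-false∷ = lincomb-map (false ∷_) λ _ _ → refl

lincomb-++ : (dz : Vec Bool p) (dw : Vec Bool m) (Z : Vec (F2^ n) p) (W : Vec (F2^ n) m) →
             lincomb (dz ++ dw) (Z ++ W) ≡ lincomb dz Z ⊕ lincomb dw W
lincomb-++ []       dw []      W = sym (⊕-identityˡ (lincomb dw W))
lincomb-++ (c ∷ dz) dw (z ∷ Z) W =
  trans (cong ((c · z) ⊕_) (lincomb-++ dz dw Z W)) (sym (⊕-assoc (c · z) _ _))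

dot-lincomb : (u : F2^ n) (c : Vec Bool k) (B : Vec (F2^ n) k) →
              ⟨ u , lincomb c B ⟩ ≡ ⟨ map ⟨ u ,_⟩ B , c ⟩
dot-lincomb u []       []      = dot-zeroʳ u
dot-lincomb u (c ∷ cs) (b ∷ B) =
  trans (dot-⊕ʳ u (c · b) (lincomb cs B))
        (cong₂ _xor_ (trans (dot-·ʳ u c b) (∧-comm c ⟨ u , b ⟩)) (dot-lincomb u cs B))

lincomb-zipWith-∷ : (c : Vec Bool n) (b : F2^ n) (T : Vec (F2^ m) n) →
                    lincomb c (zipWith _∷_ b T) ≡ ⟨ c , b ⟩ ∷ lincomb c T
lincomb-zipWith-∷ []       []       []      = refl
lincomb-zipWith-∷ (c ∷ cs) (b ∷ bs) (t ∷ T) = cong ((c · (b ∷ t)) ⊕_) (lincomb-zipWith-∷ cs bs T)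

lincomb-transpose : (c : Vec Bool n) (B : Vec (F2^ n) m) → lincomb c (transpose B) ≡ map ⟨ c ,_⟩ B
lincomb-transpose c []      = F2⁰-trivial _
lincomb-transpose c (b ∷ B) = begin
  lincomb c (transpose (b ∷ B))
    ≡⟨ sym (cong (lincomb c) (zipWith-is-⊛ _∷_ b (transpose B))) ⟩
  lincomb c (zipWith _∷_ b (transpose B))
    ≡⟨ lincomb-zipWith-∷ c b (transpose B) ⟩
  ⟨ c , b ⟩ ∷ lincomb c (transpose B)
    ≡⟨ cong (⟨ c , b ⟩ ∷_) (lincomb-transpose c B) ⟩
  ⟨ c , b ⟩ ∷ map ⟨ c ,_⟩ B
    ∎
  where open ≡-Reasoning

dependent-extension⇒∈Span : {B : Vec (F2^ n) k} {y : F2^ n} {c : Bool} {d : Vec Bool k} →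
  LinIndep B → (c ∷ d) ≢ zero-vec → (c · y) ⊕ lincomb d B ≡ zero-vec → Span B y
dependent-extension⇒∈Span {y = y} {true} {d} _ _ sum≡0 =
  d , ⊕≡0⇒≡ (trans (cong (_⊕ _) (sym (·-identityˡ y))) sum≡0)
dependent-extension⇒∈Span {B = B} {y} {false} {d} independent c∷d≢0 sum≡0 =
  ⊥-elim (c∷d≢0 (cong (false ∷_) (independent d (begin
    lincomb d B                   ≡⟨ sym (⊕-identityˡ (lincomb d B)) ⟩
    zero-vec ⊕ lincomb d B        ≡⟨ sym (cong (_⊕ lincomb d B) (·-zeroˡ y)) ⟩
    (false · y) ⊕ lincomb d B     ≡⟨ sum≡0 ⟩
    zero-vec                      ∎))))
  where open ≡-Reasoning

Dependent : Vec (F2^ n) m → Set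
Dependent Y = ∃[ d ] d ≢ zero-vec × lincomb d Y ≡ zero-vec

JointlyDependent : Vec (F2^ n) p → Vec (F2^ n) m → Set
JointlyDependent Z Y = ∃[ dz ] ∃[ dy ]
  ¬ (dz ≡ zero-vec × dy ≡ zero-vec) × lincomb dz Z ⊕ lincomb dy Y ≡ zero-vec

-- z ↦ z + z₀·(1,y) with its (now zero) first coordinate dropped.
reduceBy : F2^ k → F2^ (suc k) → F2^ k
reduceBy y z = tail z ⊕ (head z · y)

reduceBy-additive : (y : F2^ k) → Additive (reduceBy y)
reduceBy-additive y (x₀ ∷ x) (z₀ ∷ z) =
  trans (cong ((x ⊕ z) ⊕_) (·-distribʳ x₀ z₀ y)) (⊕-interchange x z (x₀ · y) (z₀ · y))

pivot-step : (L y : F2^ k) (w : F2^ (suc k)) →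
  L ⊕ reduceBy y w ≡ zero-vec → (false ∷ L) ⊕ ((head w · (true ∷ y)) ⊕ w) ≡ zero-vec
pivot-step L y (w₀ ∷ w) L+w′≡0 =
  cong₂ _∷_ (trans (cong (_xor w₀) (∧-identityʳ w₀)) (xor-same w₀))
            (trans (cong (L ⊕_) (⊕-comm (w₀ · y) w)) L+w′≡0)

-- The vectors of Z have already lost their (zero) first coordinate; a vector
-- of Y with first coordinate 1 is used as pivot to clear that coordinate in
-- the rest of Y, and its coefficient is read off afterwards.
eliminate : (∀ {m} → k < m → (Y : Vec (F2^ k) m) → Dependent Y) →
  (Z : Vec (F2^ k) p) (Y : Vec (F2^ (suc k)) m) → suc k < p + m →
  JointlyDependent (map (false ∷_) Z) Y
eliminate {k} {p} dependent-k Z [] h =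
  let d , d≢0 , Σd≡0 = dependent-k (<⇒≤ (subst (suc k <_) (+-identityʳ p) h)) Z in
  d , [] , (λ (d≡0 , _) → d≢0 d≡0) ,
  trans (⊕-identityʳ _) (trans (lincomb-false∷ d Z) (cong (false ∷_) Σd≡0))
eliminate {k} {p} {suc m} dependent-k Z ((false ∷ y) ∷ Ys) h
  with eliminate dependent-k (y ∷ Z) Ys (subst (suc k <_) (+-suc p m) h)
... | e ∷ dz , dy , nontrivial , sum≡0 =
  dz , e ∷ dy , nontrivial′ , trans (sym (⊕-rotate (e · (false ∷ y)) _ _)) sum≡0
  where
  nontrivial′ : ¬ (dz ≡ zero-vec × e ∷ dy ≡ zero-vec)
  nontrivial′ (dz≡0 , e∷dy≡0) =
    let e≡false , dy≡0 = ∷-injective e∷dy≡0 in nontrivial (cong₂ _∷_ e≡false dz≡0 , dy≡0)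
eliminate {k} {p} {suc m} dependent-k Z ((true ∷ y) ∷ Ys) h
  with dependent-k (≤-pred (subst (suc (suc k) ≤_) (+-suc p m) h)) (Z ++ map (reduceBy y) Ys)
... | d , d≢0 , Σd≡0 with splitAt p d
... | dz , dw , refl =
  dz , head w ∷ dw , nontrivial ,
  trans (cong (_⊕ ((head w · (true ∷ y)) ⊕ w)) (lincomb-false∷ dz Z))
        (pivot-step (lincomb dz Z) y w reduced)
  where
  w = lincomb dw Ys
  nontrivial : ¬ (dz ≡ zero-vec × head w ∷ dw ≡ zero-vec)
  nontrivial (dz≡0 , w₀∷dw≡0) =
    d≢0 (trans (cong₂ _++_ dz≡0 (∷-injectiveʳ w₀∷dw≡0)) (replicate-++ p false))
  reduced : lincomb dz Z ⊕ reduceBy y w ≡ zero-vec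
  reduced = begin
    lincomb dz Z ⊕ reduceBy y w
      ≡⟨ sym (cong (lincomb dz Z ⊕_) (lincomb-map (reduceBy y) (reduceBy-additive y) dw Ys)) ⟩
    lincomb dz Z ⊕ lincomb dw (map (reduceBy y) Ys)
      ≡⟨ sym (lincomb-++ dz dw Z (map (reduceBy y) Ys)) ⟩
    lincomb (dz ++ dw) (Z ++ map (reduceBy y) Ys)
      ≡⟨ Σd≡0 ⟩
    zero-vec
      ∎
    where open ≡-Reasoning

dim<length⇒dependent : ∀ k → k < m → (Y : Vec (F2^ k) m) → Dependent Y
dim<length⇒dependent zero    (s≤s _) Y = true ∷ zero-vec , (λ ()) , F2⁰-trivial _
dim<length⇒dependent (suc k) h       Y with eliminate (dim<length⇒dependent k) [] Y h
... | [] , d , nontrivial , sum≡0 =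
  d , (λ d≡0 → nontrivial (refl , d≡0)) , trans (sym (⊕-identityˡ _)) sum≡0

annihilator : (B : Vec (F2^ (suc m)) m) → LinIndep B →
  ∃[ u ] u ≢ zero-vec × (∀ y → Span B y ⇔ H u false y)
annihilator {m} B independent with dim<length⇒dependent m (n<1+n m) (transpose B)
... | u , u≢0 , Σu≡0 = u , u≢0 , λ y → mk⇔ (span⊆ker y) (ker⊆span y)
  where
  open ≡-Reasoning

  u⊥B : map ⟨ u ,_⟩ B ≡ zero-vec
  u⊥B = trans (sym (lincomb-transpose u B)) Σu≡0

  span⊆ker : ∀ y → Span B y → ⟨ u , y ⟩ ≡ false
  span⊆ker _ (c , refl) = trans (dot-lincomb u c B) (trans (cong ⟨_, c ⟩ u⊥B) (dot-zeroˡ c))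

  -- With ⟨u,v⟩ = 1, the m + 2 vectors y, v, B are dependent; pairing the
  -- relation with u kills the coefficient of v, leaving y in the span of B.
  ker⊆span : ∀ y → ⟨ u , y ⟩ ≡ false → Span B y
  ker⊆span y u·y≡0 with dot-surjective u u≢0 true
  ... | v , u·v≡1 with dim<length⇒dependent (suc m) (n<1+n (suc m)) (y ∷ v ∷ B)
  ... | d₀ ∷ d₁ ∷ d , d≢0 , Σd≡0 =
    dependent-extension⇒∈Span independent nontrivial (trans (sym without-v) Σd≡0)
    where
    d₁≡false : d₁ ≡ false
    d₁≡false = begin
      d₁                                          ≡⟨ sym (xor-identityʳ d₁) ⟩
      d₁ xor false                                ≡⟨ sym (cong (d₁ xor_) (dot-zeroˡ d)) ⟩
      ⟨ false ∷ true ∷ zero-vec , d₀ ∷ d₁ ∷ d ⟩   ≡⟨ sym (cong ⟨_, d₀ ∷ d₁ ∷ d ⟩ values) ⟩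
      ⟨ map ⟨ u ,_⟩ (y ∷ v ∷ B) , d₀ ∷ d₁ ∷ d ⟩    ≡⟨ sym (dot-lincomb u (d₀ ∷ d₁ ∷ d) (y ∷ v ∷ B)) ⟩
      ⟨ u , lincomb (d₀ ∷ d₁ ∷ d) (y ∷ v ∷ B) ⟩   ≡⟨ cong ⟨ u ,_⟩ Σd≡0 ⟩
      ⟨ u , zero-vec ⟩                            ≡⟨ dot-zeroʳ u ⟩
      false                                       ∎
      where
      values : map ⟨ u ,_⟩ (y ∷ v ∷ B) ≡ false ∷ true ∷ zero-vec
      values = cong₂ _∷_ u·y≡0 (cong₂ _∷_ u·v≡1 u⊥B)
    nontrivial : (d₀ ∷ d) ≢ zero-vec
    nontrivial d₀∷d≡0 =
      let d₀≡false , d≡0 = ∷-injective d₀∷d≡0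
      in d≢0 (cong₂ _∷_ d₀≡false (cong₂ _∷_ d₁≡false d≡0))
    without-v : (d₀ · y) ⊕ ((d₁ · v) ⊕ lincomb d B) ≡ (d₀ · y) ⊕ lincomb d B
    without-v = cong ((d₀ · y) ⊕_) (begin
      (d₁ · v) ⊕ lincomb d B      ≡⟨ cong (λ c → (c · v) ⊕ lincomb d B) d₁≡false ⟩
      (false · v) ⊕ lincomb d B   ≡⟨ cong (_⊕ lincomb d B) (·-zeroˡ v) ⟩
      zero-vec ⊕ lincomb d B      ≡⟨ ⊕-identityˡ (lincomb d B) ⟩
      lincomb d B                 ∎)

extend : Vec (F2^ n) k → Vec (F2^ (suc n)) (suc k)
extend B = (true ∷ zero-vec) ∷ map (false ∷_) B

lincomb-extend : ∀ c₀ (c : Vec Bool k) (B : Vec (F2^ n) k) →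
                 lincomb (c₀ ∷ c) (extend B) ≡ c₀ ∷ lincomb c B
lincomb-extend c₀ c B =
  trans (cong ((c₀ · (true ∷ zero-vec)) ⊕_) (lincomb-false∷ c B))
        (cong₂ _∷_ (trans (xor-identityʳ _) (∧-identityʳ c₀))
                   (trans (cong (_⊕ lincomb c B) (·-zeroʳ c₀)) (⊕-identityˡ (lincomb c B))))

extend-independent : {B : Vec (F2^ n) k} → LinIndep B → LinIndep (extend B)
extend-independent {B = B} independent (c₀ ∷ c) Σ≡0 =
  let c₀≡false , Σc≡0 = ∷-injective (trans (sym (lincomb-extend c₀ c B)) Σ≡0)
  in cong₂ _∷_ c₀≡false (independent c Σc≡0)

Span-extend : ∀ (B : Vec (F2^ n) k) y₀ y → Span (extend B) (y₀ ∷ y) ⇔ Span B y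
Span-extend B y₀ y = mk⇔
  (λ { (c₀ ∷ c , y₀∷y≡Σ) → c , ∷-injectiveʳ (trans y₀∷y≡Σ (lincomb-extend c₀ c B)) })
  (λ (c , y≡Σ) → y₀ ∷ c , trans (cong (y₀ ∷_) y≡Σ) (sym (lincomb-extend y₀ c B)))

standardBasis : ∀ n → Vec (F2^ n) n
standardBasis zero    = []
standardBasis (suc n) = extend (standardBasis n)

lincomb-standardBasis : (c : Vec Bool n) → lincomb c (standardBasis n) ≡ c
lincomb-standardBasis []       = refl
lincomb-standardBasis (c₀ ∷ c) =
  trans (lincomb-extend c₀ c (standardBasis _)) (cong (c₀ ∷_) (lincomb-standardBasis c))

graph : F2^ n → F2^ n → F2^ (suc n)
graph u y = ⟨ u , y ⟩ ∷ y

graph-additive : (u : F2^ n) → Additive (graph u)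
graph-additive u x y = cong (_∷ (x ⊕ y)) (dot-⊕ʳ u x y)

-- For u = (1,u′) the kernel is the graph of ⟨u′,·⟩; for u = (0,u′) it is
-- 𝔽₂ × ker u′.
kernel-basis : (u : F2^ (suc m)) → u ≢ zero-vec →
  Σ (Vec (F2^ (suc m)) m) λ B → LinIndep B × (∀ y → Span B y ⇔ H u false y)
kernel-basis {m} (true ∷ u) _ = B , independent , λ y → mk⇔ (span⊆ker y) (ker⊆span y)
  where
  B : Vec (F2^ (suc m)) m
  B = map (graph u) (standardBasis m)
  lincomb-B : ∀ c → lincomb c B ≡ graph u c
  lincomb-B c =
    trans (lincomb-map (graph u) (graph-additive u) c _) (cong (graph u) (lincomb-standardBasis c))
  independent : LinIndep B
  independent c Σ≡0 = ∷-injectiveʳ (trans (sym (lincomb-B c)) Σ≡0)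
  span⊆ker : ∀ y → Span B y → H (true ∷ u) false y
  span⊆ker y (c , y≡Σ) with trans y≡Σ (lincomb-B c)
  ... | refl = xor-same ⟨ u , c ⟩
  ker⊆span : ∀ y → H (true ∷ u) false y → Span B y
  ker⊆span (y₀ ∷ y) y∈ker = y , trans (cong (_∷ y) (xor≡false⇒≡ y∈ker)) (sym (lincomb-B y))
kernel-basis {zero}  (false ∷ []) u≢0 = ⊥-elim (u≢0 refl)
kernel-basis {suc m} (false ∷ u)  u≢0 =
  let B , independent , span⇔ker = kernel-basis u (u≢0 ∘ cong (false ∷_))
  in extend B , extend-independent independent ,
     λ { (y₀ ∷ y) → span⇔ker y ⇔-∘ Span-extend B y₀ y }

Coset : F2^ n → Subset n → Subset n
Coset t W y = ∃[ w ] W w × y ≡ t ⊕ w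

coset-of-kernel : (u t : F2^ n) {W : Subset n} {ε : Bool} →
  (∀ w → W w ⇔ H u false w) → ⟨ u , t ⟩ ≡ ε → ∀ y → Coset t W y ⇔ H u ε y
coset-of-kernel u t {W} {ε} W⇔ker u·t≡ε y = mk⇔ (coset⊆H y) H⊆coset
  where
  open ≡-Reasoning
  coset⊆H : ∀ y → Coset t W y → ⟨ u , y ⟩ ≡ ε
  coset⊆H _ (w , w∈W , refl) = begin
    ⟨ u , t ⊕ w ⟩              ≡⟨ dot-⊕ʳ u t w ⟩
    ⟨ u , t ⟩ xor ⟨ u , w ⟩    ≡⟨ cong₂ _xor_ u·t≡ε (Equivalence.to (W⇔ker w) w∈W) ⟩
    ε xor false                ≡⟨ xor-identityʳ ε ⟩
    ε                          ∎
  H⊆coset : ⟨ u , y ⟩ ≡ ε → Coset t W y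
  H⊆coset u·y≡ε = t ⊕ y , Equivalence.from (W⇔ker (t ⊕ y)) u·[t⊕y]≡0 , sym (⊕-cancelˡ t y)
    where
    u·[t⊕y]≡0 : ⟨ u , t ⊕ y ⟩ ≡ false
    u·[t⊕y]≡0 = trans (dot-⊕ʳ u t y) (trans (cong₂ _xor_ u·t≡ε u·y≡ε) (xor-same ε))

IsHyperplane : Subset n → Set
IsHyperplane S = ∃[ u ] ∃[ ε ] u ≢ zero-vec × (∀ y → S y ⇔ H u ε y)

flat⇒hyperplane : {S : Subset (suc m)} → IsFlat m S → IsHyperplane S
flat⇒hyperplane (t , W , (B , independent , W⇔span) , S⇔coset) =
  let u , u≢0 , span⇔ker = annihilator B independent
  in u , ⟨ u , t ⟩ , u≢0 ,
     λ y → coset-of-kernel u t (λ w → span⇔ker w ⇔-∘ W⇔span w) refl y ⇔-∘ S⇔coset y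

hyperplane⇒flat : {S : Subset (suc m)} → IsHyperplane S → IsFlat m S
hyperplane⇒flat (u , ε , u≢0 , S⇔H) =
  let t , u·t≡ε = dot-surjective u u≢0 ε
      B , independent , span⇔ker = kernel-basis u u≢0
  in t , H u false , (B , independent , ⇔-sym ∘ span⇔ker) ,
     λ y → ⇔-sym (coset-of-kernel u t (λ w → ⇔-id _) u·t≡ε y) ⇔-∘ S⇔H y

record AffineVia (f : Per n) (a : F2^ n) : Set where
  constructor affineVia
  field
    u : F2^ n
    ε : Bool
    ⟨a,x⟩≡⟨u,fx⟩+ε : ∀ x → ⟨ a , x ⟩ ≡ ⟨ u , Inverse.to f x ⟩ xor ε

affineVia-zero : {f : Per n} → AffineVia f zero-vec
affineVia-zero {f = f} =
  affineVia zero-vec false λ x →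
    trans (dot-zeroˡ x) (sym (cong (_xor false) (dot-zeroˡ (Inverse.to f x))))

affineVia-⊕ : {f : Per n} {a b : F2^ n} → AffineVia f a → AffineVia f b → AffineVia f (a ⊕ b)
affineVia-⊕ {f = f} {a} {b} (affineVia u ε a≈u) (affineVia v η b≈v) =
  affineVia (u ⊕ v) (ε xor η) λ x →
  let y = Inverse.to f x in begin
  ⟨ a ⊕ b , x ⟩                                ≡⟨ dot-⊕ˡ a b x ⟩
  ⟨ a , x ⟩ xor ⟨ b , x ⟩                      ≡⟨ cong₂ _xor_ (a≈u x) (b≈v x) ⟩
  (⟨ u , y ⟩ xor ε) xor (⟨ v , y ⟩ xor η)      ≡⟨ xor-interchange ⟨ u , y ⟩ ε ⟨ v , y ⟩ η ⟩
  (⟨ u , y ⟩ xor ⟨ v , y ⟩) xor (ε xor η)      ≡⟨ sym (cong (_xor (ε xor η)) (dot-⊕ˡ u v y)) ⟩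
  ⟨ u ⊕ v , y ⟩ xor (ε xor η)                  ∎
  where open ≡-Reasoning

affineVia-· : {f : Per n} {a : F2^ n} (c : Bool) → AffineVia f a → AffineVia f (c · a)
affineVia-· {f = f} {a} true  = subst (AffineVia f) (sym (·-identityˡ a))
affineVia-· {f = f} {a} false _ = subst (AffineVia f) (sym (·-zeroˡ a)) affineVia-zero

image-hyperplane⇒affineVia : {f : Per n} {a : F2^ n} →
  IsHyperplane (image f (H a false)) → AffineVia f a
image-hyperplane⇒affineVia {f = f} {a} (u , ε , _ , img⇔H) = affineVia u ε λ x →
  ≡xor-from-⇔ (mk⇔ (λ a·x≡0 → Equivalence.to (img⇔H _) (x , a·x≡0 , refl)) (fx∈H⇒x∈H x))
  where
  fx∈H⇒x∈H : ∀ x → ⟨ u , Inverse.to f x ⟩ ≡ ε → ⟨ a , x ⟩ ≡ false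
  fx∈H⇒x∈H x fx∈H =
    let x′ , a·x′≡0 , fx′≡fx = Equivalence.from (img⇔H _) fx∈H
    in subst (λ z → ⟨ a , z ⟩ ≡ false) (Injection.injective (↔⇒↣ f) fx′≡fx) a·x′≡0

affineVia⇒image-hyperplane : {f : Per n} {a : F2^ n} →
  a ≢ zero-vec → AffineVia f a → IsHyperplane (image f (H a false))
affineVia⇒image-hyperplane {f = f} {a} a≢0 (affineVia u ε a≈u) =
  u , ε , u≢0 , λ y → mk⇔ (img⊆H y) (H⊆img y)
  where
  constant : u ≡ zero-vec → ∀ x → ⟨ a , x ⟩ ≡ ε
  constant u≡0 x = begin
    ⟨ a , x ⟩                                ≡⟨ a≈u x ⟩
    ⟨ u , Inverse.to f x ⟩ xor ε             ≡⟨ cong (λ v → ⟨ v , Inverse.to f x ⟩ xor ε) u≡0 ⟩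
    ⟨ zero-vec , Inverse.to f x ⟩ xor ε      ≡⟨ cong (_xor ε) (dot-zeroˡ (Inverse.to f x)) ⟩
    ε                                        ∎
    where open ≡-Reasoning
  -- If u = 0 then ⟨a,·⟩ would be constant, but it takes both values.
  u≢0 : u ≢ zero-vec
  u≢0 u≡0 =
    let x , a·x≡1 = dot-surjective a a≢0 true in
    contradiction (begin
      true               ≡⟨ sym a·x≡1 ⟩
      ⟨ a , x ⟩          ≡⟨ constant u≡0 x ⟩
      ε                  ≡⟨ sym (constant u≡0 zero-vec) ⟩
      ⟨ a , zero-vec ⟩   ≡⟨ dot-zeroʳ a ⟩
      false              ∎) λ ()
    where open ≡-Reasoning
  img⊆H : ∀ y → image f (H a false) y → ⟨ u , y ⟩ ≡ ε
  img⊆H _ (x , a·x≡0 , refl) = xor≡false⇒≡ (trans (sym (a≈u x)) a·x≡0)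
  H⊆img : ∀ y → ⟨ u , y ⟩ ≡ ε → image f (H a false) y
  H⊆img y u·y≡ε =
    Inverse.from f y ,
    trans (a≈u _) (trans (cong (λ z → ⟨ u , z ⟩ xor ε) (Inverse.strictlyInverseˡ f y))
                         (trans (cong (_xor ε) u·y≡ε) (xor-same ε))) ,
    Inverse.strictlyInverseˡ f y

V⇔AffineVia : (f : Per n) (a : F2^ n) → V f a ⇔ AffineVia f a
V⇔AffineVia {n} f a = mk⇔ (V⇒affineVia n a) (affineVia⇒V n a)
  where
  V⇒affineVia : ∀ n (a : F2^ n) {f : Per n} → V f a → AffineVia f a
  V⇒affineVia _       _  (inj₁ (lift refl))   = affineVia-zero
  V⇒affineVia zero    [] (inj₂ (a≢0 , _))     = ⊥-elim (a≢0 refl)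
  V⇒affineVia (suc m) _  (inj₂ (_ , flat))    = image-hyperplane⇒affineVia (flat⇒hyperplane flat)
  affineVia⇒V : ∀ n (a : F2^ n) {f : Per n} → AffineVia f a → V f a
  affineVia⇒V zero    [] _ = inj₁ (lift refl)
  affineVia⇒V (suc m) a  a∈A with ≡-dec _≟_ a zero-vec
  ... | yes a≡0 = inj₁ (lift a≡0)
  ... | no  a≢0 = inj₂ (a≢0 , hyperplane⇒flat (affineVia⇒image-hyperplane a≢0 a∈A))

lemma5p1 : (n : ℕ) (f : Per n) → IsSubspace (V f)
lemma5p1 n f =
  inj₁ (lift refl) ,
  (λ a b a∈V b∈V → from (a ⊕ b) (affineVia-⊕ (to a a∈V) (to b b∈V))) ,
  (λ c a a∈V → from (c · a) (affineVia-· c (to a a∈V)))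
  where
  to : ∀ a → V f a → AffineVia f a
  to a = Equivalence.to (V⇔AffineVia f a)
  from : ∀ a → AffineVia f a → V f a
  from a = Equivalence.from (V⇔AffineVia f a)
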